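{- Let $X$ and $Z$ be subsets of $\mathcal{S}_N$ with $Z\cap\mathcal{E}(X)=\emptyset$. Then $|\mathcal{E}(Z)|\le|\mathcal{E}(\mathcal{S}_N\setminus\mathcal{E}(X))|$.
   Context: $\mathcal{S}_N$ is the set of nonzero tuples in $\{ -1,0,1\}^N$ whose first nonzero entry is $1$. A tuple $t\in\{1,0,-1,u\}^N$ eliminates $s\in\mathcal{S}_N$ if: (i) $t_i\neq0$ and $s_i\ne0$ for some $i$; (ii) there is $k\in\{+1,-1\}$ with $t_i=ks_i$ for all $i$ with $s_i\ne0$ and $t_i\ne0$; (iii) $s_i=0$ whenever $t_i=u$. For $X\subseteq\mathcal{S}_N$, $\mathcal{E}(X)$ is the set of elements of $\mathcal{S}_N$ eliminated by some element of $X$. -}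

module Defs where

open import Data.Bool using (Bool; true; false; _∧_; _∨_; not; if_then_else_)
open import Data.Nat using (ℕ; zero; suc)
open import Data.Fin using (Fin)
open import Data.List using (List; []; _∷_; length; filterᵇ; allFin; concatMap; map)
open import Data.Vec using (Vec; []; _∷_; lookup)
open import Data.Bool.ListAction using (any; all)
open import Relation.Binary.PropositionalEquality using (_≡_)

data Trit : Set where
  p1 z0 m1 : Trit

-- Entries of eliminating tuples : {1, 0, -1, u}
data Sym : Set where
  p1 z0 m1 u : Sym

embed : Trit → Sym
embed p1 = p1
embed z0 = z0
embed m1 = m1

embedV : ∀ {N} → Vec Trit N → Vec Sym N
embedV []       = []
embedV (x ∷ xs) = embed x ∷ embedV xs

data Sign : Set where
  plus minus : Sign

scale : Sign → Trit → Sym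
scale plus  s  = embed s
scale minus p1 = m1
scale minus z0 = z0
scale minus m1 = p1

_==S_ : Sym → Sym → Bool
p1 ==S p1 = true
z0 ==S z0 = true
m1 ==S m1 = true
u  ==S u  = true
_  ==S _  = false

nzT : Trit → Bool
nzT z0 = false
nzT _  = true

nzS : Sym → Bool
nzS z0 = false
nzS _  = true

isU : Sym → Bool
isU u = true
isU _ = false

_⇒b_ : Bool → Bool → Bool
a ⇒b b = not a ∨ b

firstNonzeroIsOne : ∀ {N} → Vec Trit N → Bool
firstNonzeroIsOne []        = false   -- the zero tuple is excluded
firstNonzeroIsOne (p1 ∷ _)  = true
firstNonzeroIsOne (m1 ∷ _)  = false
firstNonzeroIsOne (z0 ∷ xs) = firstNonzeroIsOne xs

inS : ∀ {N} → Vec Trit N → Bool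
inS = firstNonzeroIsOne

eliminates : ∀ {N} → Vec Sym N → Vec Trit N → Bool
eliminates {N} t s = cond1 ∧ cond2 ∧ cond3
  where
  cond1 = any (λ i → nzS (lookup t i) ∧ nzT (lookup s i)) (allFin N)
  agreeWith : Sign → Bool
  agreeWith k = all (λ i → (nzT (lookup s i) ∧ nzS (lookup t i))
                            ⇒b (lookup t i ==S scale k (lookup s i))) (allFin N)
  cond2 = agreeWith plus ∨ agreeWith minus
  cond3 = all (λ i → isU (lookup t i) ⇒b not (nzT (lookup s i))) (allFin N)

allTuples : ∀ N → List (Vec Trit N)
allTuples zero    = [] ∷ []
allTuples (suc N) = concatMap (λ v → map (_∷ v) (p1 ∷ z0 ∷ m1 ∷ [])) (allTuples N)

Subset : ℕ → Set
Subset N = Vec Trit N → Bool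

_⊆S : ∀ {N} → Subset N → Set
_⊆S {N} A = ∀ (s : Vec Trit N) → A s ≡ true → inS s ≡ true

SN : ∀ N → Subset N
SN N = inS

E : ∀ {N} → Subset N → Subset N
E {N} X s = inS s ∧ any (λ x → X x ∧ eliminates (embedV x) s) (allTuples N)

_∖_ : ∀ {N} → Subset N → Subset N → Subset N
(A ∖ B) s = A s ∧ not (B s)

card : ∀ {N} → Subset N → ℕ
card {N} A = length (filterᵇ A (allTuples N))

module Submission where

open import Defs
open import Data.Nat using (ℕ; _≤_)
open import Data.Bool using (Bool; true; false; T; _∧_)
open import Data.Bool.Properties using (T-≡)
open import Data.Bool.ListAction using (any)
open import Data.Vec using (Vec)
open import Data.List using (List; length; filterᵇ)
import Data.List.Relation.Unary.Any as Any
open import Data.List.Relation.Unary.Any.Properties using (any⁺; any⁻)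
open import Data.List.Relation.Binary.Sublist.Propositional using (⊆-refl)
open import Data.List.Relation.Binary.Sublist.Propositional.Properties using (filter⁺; length-mono-≤)
open import Function using (_∘_; Equivalence)
open import Relation.Binary.PropositionalEquality using (_≡_; refl)
open import Relation.Nullary.Decidable using (T?)

open Equivalence

_⊆ᵇ_ : {A : Set} → (A → Bool) → (A → Bool) → Set
f ⊆ᵇ g = ∀ x → f x ≡ true → g x ≡ true

⊆ᵇ⇒T : {A : Set} {f g : A → Bool} → f ⊆ᵇ g → ∀ {x} → T (f x) → T (g x)
⊆ᵇ⇒T f⊆g {x} = from T-≡ ∘ f⊆g x ∘ to T-≡

length-filterᵇ-mono : {A : Set} {f g : A → Bool} → f ⊆ᵇ g →
  (xs : List A) → length (filterᵇ f xs) ≤ length (filterᵇ g xs)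
length-filterᵇ-mono {f = f} {g} f⊆g xs =
  length-mono-≤ (filter⁺ (T? ∘ f) (T? ∘ g) (λ { refl → ⊆ᵇ⇒T f⊆g }) (⊆-refl {x = xs}))

any-mono : {A : Set} {f g : A → Bool} → f ⊆ᵇ g →
  (xs : List A) → any f xs ≡ true → any g xs ≡ true
any-mono {f = f} {g} f⊆g xs =
  to T-≡ ∘ any⁺ g ∘ Any.map (⊆ᵇ⇒T f⊆g) ∘ any⁻ f xs ∘ from T-≡

∧-monoˡ-true : ∀ {a a′} b → (a ≡ true → a′ ≡ true) → a ∧ b ≡ true → a′ ∧ b ≡ true
∧-monoˡ-true {true} b a⇒a′ ab rewrite a⇒a′ refl = ab

∧-monoʳ-true : ∀ a {b b′} → (b ≡ true → b′ ≡ true) → a ∧ b ≡ true → a ∧ b′ ≡ true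
∧-monoʳ-true true b⇒b′ = b⇒b′

card-mono : ∀ {N} {A B : Subset N} → A ⊆ᵇ B → card A ≤ card B
card-mono {N} A⊆B = length-filterᵇ-mono A⊆B (allTuples N)

E-mono : ∀ {N} {X Y : Subset N} → X ⊆ᵇ Y → E X ⊆ᵇ E Y
E-mono {N} X⊆Y s =
  ∧-monoʳ-true (inS s)
    (any-mono (λ x → ∧-monoˡ-true (eliminates (embedV x) s) (X⊆Y x)) (allTuples N))

⊆-SN∖E : ∀ {N} {X Z : Subset N} → Z ⊆S →
  ((s : Vec Trit N) → Z s ≡ true → E X s ≡ false) → Z ⊆ᵇ (SN N ∖ E X)
⊆-SN∖E Z⊆S Z∩EX≡∅ s zs rewrite Z∩EX≡∅ s zs | Z⊆S s zs = refl

mainTheorem7 : (N : ℕ) (X Z : Subset N) → X ⊆S → Z ⊆S →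
    ((s : Vec Trit N) → Z s ≡ true → E X s ≡ false) →
    card (E Z) ≤ card (E (SN N ∖ E X))
mainTheorem7 N X Z _ Z⊆S Z∩EX≡∅ =
  card-mono (E-mono {X = Z} (⊆-SN∖E {X = X} Z⊆S Z∩EX≡∅))
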